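{- Let $s\ge 1$ and $t\ge 1$ be integers. Then $\chi_p(P_{2t}\Diamond_2 C_{4s+3})\le 4$ if $1\le t\le 2$, and $\chi_p(P_{2t}\Diamond_2 C_{4s+3})\le 5$ if $t\ge 3$. Moreover, equality holds for $t\in\{1,2\}$.
   Context: A packing $k$-coloring of a graph $H$ is a map $c:V(H)\to\{1,\ldots,k\}$ such that any two distinct vertices $u,v$ with $c(u)=c(v)=i$ satisfy $d_H(u,v)\ge i+1$. The packing chromatic number $\chi_p(H)$ is the least such $k$. $P_m$ denotes the path $v_1\cdots v_m$ and $C_n$ the cycle on $n$ vertices. Path-aligned product: for positive integers $\ell\mid m$ and a connected vertex-transitive graph $G$ containing $P_\ell$ as a subgraph, $P_m\Diamond_\ell G$ is formed from the path $P_m=v_1\cdots v_m$ and $m/\ell$ pairwise disjoint copies of $G$, where for each $1\le i\le m/\ell$ the consecutive path vertices $v_{(i-1)\ell+1},\ldots,v_{i\ell}$ are identified, in order, with the vertices of a path $P_\ell$ (i.e. $\ell$ consecutive cycle vertices when $G$ is a cycle) in the $i$-th copy of $G$. -}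

module Defs where

open import Data.Nat using (ℕ; zero; suc; _+_; _*_; _≤_; _%_; pred)
open import Data.Fin using (Fin; toℕ)
open import Data.Product using (_×_; _,_; Σ)
open import Data.Sum using (_⊎_)
open import Relation.Binary.PropositionalEquality using (_≡_)
open import Relation.Nullary using (¬_)

record Graph : Set₁ where
  field
    V   : Set
    Adj : V → V → Set

open Graph public

data Walk (H : Graph) : V H → V H → Set where
  []  : ∀ {u} → Walk H u u
  _∷_ : ∀ {u v w} → Adj H u v → Walk H v w → Walk H u w

length : ∀ {H u v} → Walk H u v → ℕ
length []       = 0
length (_ ∷ w) = suc (length w)

-- d_H(u,v) ≥ d  :  every u–v walk has length at least d
-- (vacuous if u and v lie in different components, where d_H = ∞).
DistAtLeast : (H : Graph) → V H → V H → ℕ → Set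
DistAtLeast H u v d = (w : Walk H u v) → d ≤ length w

IsPackingColoring : (H : Graph) (k : ℕ) → (V H → ℕ) → Set
IsPackingColoring H k c =
  (∀ v → 1 ≤ c v × c v ≤ k) ×
  (∀ u v → ¬ (u ≡ v) → c u ≡ c v → DistAtLeast H u v (suc (c u)))

HasPackingColoring : Graph → ℕ → Set
HasPackingColoring H k = Σ (V H → ℕ) (IsPackingColoring H k)

PackingChromaticNumberIs : Graph → ℕ → Set
PackingChromaticNumberIs H k =
  HasPackingColoring H k × (∀ j → suc j ≤ k → ¬ HasPackingColoring H j)

CycleAdj : (n : ℕ) → Fin n → Fin n → Set
CycleAdj n j j' =
  toℕ j' ≡ (suc (toℕ j)) % suc (pred n) ⊎ toℕ j ≡ (suc (toℕ j')) % suc (pred n)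

-- P_{2t} ◇_2 C_n : t disjoint copies of C_n (copy i has vertices (i , j), j ∈ Fin n);
-- path vertices v_{2i+1}, v_{2i+2} are identified with cycle vertices 0, 1 of copy i
-- (0-indexed i), so the remaining path edges are v_{2i+2} v_{2i+3}, i.e. (i,1) — (i+1,0).
PathAlignedAdj : (t n : ℕ) → (Fin t × Fin n) → (Fin t × Fin n) → Set
PathAlignedAdj t n (i , j) (i' , j') =
  (i ≡ i' × CycleAdj n j j')
  ⊎ (toℕ i' ≡ suc (toℕ i) × toℕ j ≡ 1 × toℕ j' ≡ 0)
  ⊎ (toℕ i ≡ suc (toℕ i') × toℕ j' ≡ 1 × toℕ j ≡ 0)

PathAligned2Cycle : (t n : ℕ) → Graph
PathAligned2Cycle t n = record { V = Fin t × Fin n ; Adj = PathAlignedAdj t n }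

{-# OPTIONS --safe #-}
-- Lower bound: in a packing colouring of an odd cycle of length at least 5 with colours
-- 1, 2, 3, two consecutive vertices cannot both avoid colour 1 (the colours 2 and 3 next to
-- each other leave no colour for a vertex two steps further), and colour 1 is independent;
-- so colour 1 would alternate around an odd cycle. The first copy of C₄ₛ₊₃ is such a cycle.
--
-- Upper bound: every copy is coloured 1 at the even positions 0, 2, …, 4s, 2 and 3 alternately
-- at the odd positions below 4s, and 2, 4 or 5 at the last two positions (see colour). A walk
-- of length L from (a , j) either stays in copy a within an arc of length at most L, or leaves
-- it through (a , 1) or (a , 0) and pays 2Δ + 1 edges to reach a copy Δ + 1 further away.
-- Abstracting positions to seven phases, independent of s, turns the resulting separation
-- conditions into a finite check.
module Submission where

open import Defs
open import Data.Fin as F using (Fin; toℕ)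
open import Data.Fin.Properties using (toℕ<n; toℕ≤pred[n]; toℕ-injective; toℕ-fromℕ<)
open import Data.List using (List; []; _∷_; _++_; concatMap)
open import Data.List.Membership.Propositional using (_∈_; lose)
open import Data.List.Membership.Propositional.Properties using (∈-++⁺ˡ; ∈-++⁺ʳ; ∈-concatMap⁺)
open import Data.List.Relation.Unary.All using (All; all?; lookup)
open import Data.List.Relation.Unary.Any using (here; there)
open import Data.Nat using (ℕ; zero; suc; _+_; _*_; _%_; _≤_; _<_; _≤?_; _<?_; _≟_; z≤n; s≤s; s≤s⁻¹; z<s; s<s; NonZero)
open import Data.Nat.DivMod using (_mod_; m%n<n; m<n⇒m%n≡m; n%n≡0; m%n%n≡m%n; %-distribˡ-+; [m+n]%n≡m%n)
open import Data.Nat.GeneralisedArithmetic using (fold; fold-+)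
open import Data.Nat.Properties
open import Algebra.Properties.CommutativeSemigroup +-commutativeSemigroup using (x∙yz≈y∙xz)
open import Data.Product using (Σ-syntax; ∃-syntax; _×_; _,_; proj₁; proj₂)
open import Data.Sum using (_⊎_; inj₁; inj₂)
open import Data.Empty using (⊥; ⊥-elim)
open import Function using (_∘_; _⇔_; mk⇔; Equivalence)
open import Relation.Nullary using (¬_; Dec; yes; no; ¬?; contradiction)
open import Relation.Binary.Definitions using (tri<; tri≈; tri>)
open import Relation.Nullary.Decidable using (_→-dec_; _×-dec_; True; toWitness)
open import Relation.Binary.PropositionalEquality using (_≡_; _≢_; refl; sym; trans; cong; cong₂; subst; module ≡-Reasoning)

walk-along : ∀ {H} (γ : ℕ → V H) → (∀ q → Adj H (γ q) (γ (suc q))) →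
  ∀ d q → Σ[ w ∈ Walk H (γ q) (γ (d + q)) ] length w ≡ d
walk-along γ edge zero    q = [] , refl
walk-along γ edge (suc d) q with walk-along (γ ∘ suc) (edge ∘ suc) d q
... | w , |w|≡d = edge q ∷ w , cong suc |w|≡d

walk-invariant : ∀ {H} (R : V H → ℕ → Set) → (∀ {x y L} → Adj H x y → R x L → R y (suc L)) →
  ∀ {x y L} → R x L → (w : Walk H x y) → R y (L + length w)
walk-invariant R step {L = L} r []      = subst (R _) (sym (+-identityʳ L)) r
walk-invariant R step {L = L} r (e ∷ w) =
  subst (R _) (sym (+-suc L (length w))) (walk-invariant R step (step e r) w)

[m+o%n]%n≡[m+o]%n : ∀ m o n .{{_ : NonZero n}} → (m + o % n) % n ≡ (m + o) % n
[m+o%n]%n≡[m+o]%n m o n = begin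
  (m + o % n) % n           ≡⟨ %-distribˡ-+ m (o % n) n ⟩
  (m % n + o % n % n) % n   ≡⟨ cong (λ r → (m % n + r) % n) (m%n%n≡m%n o n) ⟩
  (m % n + o % n) % n       ≡⟨ %-distribˡ-+ m o n ⟨
  (m + o) % n               ∎
  where open ≡-Reasoning

[m+x]%n≢x : ∀ {m x n} .{{_ : NonZero n}} → 0 < m → m < n → x < n → (m + x) % n ≢ x
[m+x]%n≢x {m} {x} {n} 0<m m<n x<n e with m + x <? n
... | yes m+x<n = <⇒≢ (+-monoˡ-< x 0<m) (sym (trans (sym (m<n⇒m%n≡m m+x<n)) e))
... | no m+x≮n = wrap-around (m≤n⇒∃[o]m+o≡n (≮⇒≥ m+x≮n))
  where
  wrap-around : ∃[ y ] n + y ≡ m + x → ⊥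
  wrap-around (y , n+y≡m+x) = <⇒≢ y<x (begin
    y             ≡⟨ m<n⇒m%n≡m (<-trans y<x x<n) ⟨
    y % n         ≡⟨ [m+n]%n≡m%n y n ⟨
    (y + n) % n   ≡⟨ cong (_% n) (trans (+-comm y n) n+y≡m+x) ⟩
    (m + x) % n   ≡⟨ e ⟩
    x             ∎)
    where
    open ≡-Reasoning
    y<x : y < x
    y<x = +-cancelˡ-< n y x (subst (_< n + x) (sym n+y≡m+x) (+-monoˡ-< x m<n))

[m+o]%n≢o%n : ∀ {m} o {n} .{{_ : NonZero n}} → 0 < m → m < n → (m + o) % n ≢ o % n
[m+o]%n≢o%n {m} o {n} 0<m m<n eq =
  [m+x]%n≢x 0<m m<n (m%n<n o n) (trans ([m+o%n]%n≡[m+o]%n m o n) eq)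

-- Odd cycles need four colours

data Colour₃ (x : ℕ) : Set where
  one   : x ≡ 1 → Colour₃ x
  two   : x ≡ 2 → Colour₃ x
  three : x ≡ 3 → Colour₃ x

colour₃ : ∀ {x} → 1 ≤ x → x ≤ 3 → Colour₃ x
colour₃ {1} _ _ = one refl
colour₃ {2} _ _ = two refl
colour₃ {3} _ _ = three refl
colour₃ {suc (suc (suc (suc _)))} _ (s≤s (s≤s (s≤s ())))

-- A packing colouring h of the ray 0 — 1 — 2 — ⋯ with colours 1, 2, 3
-- (q and suc d + q are at distance suc d).
module _ {h : ℕ → ℕ} (range : ∀ q → 1 ≤ h q × h q ≤ 3)
         (apart : ∀ q d → h q ≡ h (suc d + q) → h q ≤ d) where

  private
    colour-of : ∀ q → Colour₃ (h q)
    colour-of q = colour₃ (proj₁ (range q)) (proj₂ (range q))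

    clash : ∀ q d {c} → h q ≡ c → h (suc d + q) ≡ c → d < c → ⊥
    clash q d hq≡c hq′≡c d<c = <⇒≱ d<c (subst (_≤ d) hq≡c (apart q d (trans hq≡c (sym hq′≡c))))

    two-three : ∀ q → h (2 + q) ≡ 2 → h (3 + q) ≡ 3 → ⊥
    two-three q x y with colour-of (1 + q)
    ... | two a   = clash (1 + q) 0 a x z<s
    ... | three a = clash (1 + q) 1 a y (s<s z<s)
    ... | one a with colour-of q
    ...   | one a′   = clash q 0 a′ a z<s
    ...   | two a′   = clash q 1 a′ x ≤-refl
    ...   | three a′ = clash q 2 a′ y ≤-refl

    three-two : ∀ q → h (2 + q) ≡ 3 → h (3 + q) ≡ 2 → ⊥
    three-two q x y with colour-of (4 + q)
    ... | two b   = clash (3 + q) 0 y b z<s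
    ... | three b = clash (2 + q) 1 x b (s<s z<s)
    ... | one b with colour-of (5 + q)
    ...   | one b′   = clash (4 + q) 0 b b′ z<s
    ...   | two b′   = clash (3 + q) 1 y b′ ≤-refl
    ...   | three b′ = clash (2 + q) 2 x b′ ≤-refl

  one-of-two-has-colour-1 : ∀ q → h (2 + q) ≡ 1 ⊎ h (3 + q) ≡ 1
  one-of-two-has-colour-1 q with colour-of (2 + q) | colour-of (3 + q)
  ... | one x   | _       = inj₁ x
  ... | _       | one y   = inj₂ y
  ... | two x   | two y   = ⊥-elim (clash (2 + q) 0 x y z<s)
  ... | three x | three y = ⊥-elim (clash (2 + q) 0 x y z<s)
  ... | two x   | three y = ⊥-elim (two-three q x y)
  ... | three x | two y   = ⊥-elim (three-two q x y)

record Alternating (P : ℕ → Set) : Set where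
  field
    one-of   : ∀ q → P q ⊎ P (suc q)
    not-both : ∀ q → P q → ¬ P (suc q)

alternating-every-other : ∀ {P} → Alternating P → ∀ k {q} → P q → P (k * 2 + q)
alternating-every-other alt zero    Pq = Pq
alternating-every-other alt (suc k) {q} Pq with Alternating.one-of alt (suc (k * 2 + q))
... | inj₁ P₁ =
  contradiction P₁ (Alternating.not-both alt (k * 2 + q) (alternating-every-other alt k Pq))
... | inj₂ P₂ = P₂

alternating-¬odd-period : ∀ {P} → Alternating P → ∀ r → ¬ (P 0 ⇔ P (suc (r * 2)))
alternating-¬odd-period {P} alt r period with Alternating.one-of alt 0
... | inj₁ P₀ = Alternating.not-both alt (r * 2)
                  (subst P (+-identityʳ (r * 2)) (alternating-every-other alt r P₀))
                  (Equivalence.to period P₀)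
... | inj₂ P₁ = Alternating.not-both alt 0
                  (Equivalence.from period (subst P (+-comm (r * 2) 1) (alternating-every-other alt r P₁)))
                  P₁

-- A cycle of length 2r + 1 in H, traversed again and again.
record OddCycle (H : Graph) (r : ℕ) : Set where
  field
    vertex : ℕ → V H
    edge   : ∀ q → Adj H (vertex q) (vertex (suc q))
    closed : ∀ q → vertex (q + suc (r * 2)) ≡ vertex q
    simple : ∀ q d → suc d < suc (r * 2) → vertex q ≢ vertex (suc d + q)

odd-cycle⇒¬packing-3-colouring : ∀ {H r k} → OddCycle H r → 2 ≤ r → k ≤ 3 → ¬ HasPackingColoring H k
odd-cycle⇒¬packing-3-colouring {H} {r} C 2≤r k≤3 (f , f-range , f-packed) =
  alternating-¬odd-period alternating r period
  where
  open OddCycle C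

  h : ℕ → ℕ
  h q = f (vertex q)

  range : ∀ q → 1 ≤ h q × h q ≤ 3
  range q = proj₁ (f-range (vertex q)) , ≤-trans (proj₂ (f-range (vertex q))) k≤3

  apart : ∀ q d → h q ≡ h (suc d + q) → h q ≤ d
  apart q d same with d <? 3
  ... | no d≮3 = ≤-trans (proj₂ (range q)) (≮⇒≥ d≮3)
  ... | yes d<3 with walk-along vertex edge (suc d) q
  ...   | w , |w|≡1+d =
    s≤s⁻¹ (subst (suc (h q) ≤_) |w|≡1+d
      (f-packed (vertex q) (vertex (suc d + q)) (simple q d 1+d<2r+1) same w))
    where
    1+d<2r+1 : suc d < suc (r * 2)
    1+d<2r+1 = s≤s (≤-trans d<3 (≤-trans (n≤1+n 3) (*-monoˡ-≤ 2 2≤r)))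

  P : ℕ → Set
  P q = h (2 + q) ≡ 1

  alternating : Alternating P
  alternating = record
    { one-of   = one-of-two-has-colour-1 range apart
    ; not-both = λ q P₀ P₁ → <⇒≱ (proj₁ (range (2 + q))) (apart (2 + q) 0 (trans P₀ (sym P₁)))
    }

  period : P 0 ⇔ P (suc (r * 2))
  period = mk⇔ (trans (cong f (closed 2))) (trans (cong f (sym (closed 2))))

module Cycle (m : ℕ) where

  next : ℕ → ℕ
  next j = suc j % suc m

  next≤m : ∀ j → next j ≤ m
  next≤m j = s≤s⁻¹ (m%n<n (suc j) (suc m))

  next-suc : ∀ {j} → j < m → next j ≡ suc j
  next-suc j<m = m<n⇒m%n≡m (s≤s j<m)

  next-last : next m ≡ 0
  next-last = n%n≡0 (suc m)

  next-injective : ∀ {x y} → x ≤ m → y ≤ m → next x ≡ next y → x ≡ y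
  next-injective x≤m y≤m eq with m≤n⇒m<n∨m≡n x≤m | m≤n⇒m<n∨m≡n y≤m
  ... | inj₁ x<m | inj₁ y<m = suc-injective (trans (sym (next-suc x<m)) (trans eq (next-suc y<m)))
  ... | inj₁ x<m | inj₂ refl = contradiction (trans (sym (next-suc x<m)) (trans eq next-last)) λ ()
  ... | inj₂ refl | inj₁ y<m = contradiction (trans (sym next-last) (trans eq (next-suc y<m))) λ ()
  ... | inj₂ refl | inj₂ refl = refl

  fold-next≤m : ∀ {x} d → x ≤ m → fold x next d ≤ m
  fold-next≤m zero    x≤m = x≤m
  fold-next≤m (suc d) _   = next≤m _

  fold-next : ∀ x d → fold (next x) next d ≡ next (fold x next d)
  fold-next x zero    = refl
  fold-next x (suc d) = cong next (fold-next x d)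

  data Arc (d x y : ℕ) : Set where
    forward  : y ≡ fold x next d → Arc d x y
    backward : x ≡ fold y next d → Arc d x y

  Within : ℕ → ℕ → ℕ → Set
  Within L x y = ∃[ d ] d ≤ L × Arc d x y

  Arc-sym : ∀ {d x y} → Arc d x y → Arc d y x
  Arc-sym (forward e)  = backward e
  Arc-sym (backward e) = forward e

  Within-refl : ∀ {x} → Within 0 x x
  Within-refl = 0 , z≤n , forward refl

  Within-sym : ∀ {L x y} → Within L x y → Within L y x
  Within-sym (d , d≤L , arc) = d , d≤L , Arc-sym arc

  Within-mono : ∀ {L L′ x y} → L ≤ L′ → Within L x y → Within L′ x y
  Within-mono L≤L′ (d , d≤L , arc) = d , ≤-trans d≤L L≤L′ , arc

  Within-pos : ∀ {L x y} → x ≢ y → Within L x y → 1 ≤ L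
  Within-pos x≢y (zero  , _   , forward y≡x) = contradiction (sym y≡x) x≢y
  Within-pos x≢y (zero  , _   , backward x≡y) = contradiction x≡y x≢y
  Within-pos x≢y (suc d , d≤L , _)        = ≤-trans (s≤s z≤n) d≤L

  Within-step : ∀ {L x y y′} → x ≤ m → y′ ≤ m → y′ ≡ next y ⊎ y ≡ next y′ →
    Within L x y → Within (suc L) x y′
  Within-step x≤m y′≤m (inj₁ refl) (d , d≤L , forward refl) = suc d , s≤s d≤L , forward refl
  Within-step x≤m y′≤m (inj₁ refl) (zero , _ , backward refl) = 1 , s≤s z≤n , forward refl
  Within-step x≤m y′≤m (inj₁ refl) (suc d , d<L , backward refl) =
    d , m≤n⇒m≤1+n (<⇒≤ d<L) , backward (sym (fold-next _ d))
  Within-step x≤m y′≤m (inj₂ e) (zero , _ , forward refl) = 1 , s≤s z≤n , backward e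
  Within-step x≤m y′≤m (inj₂ e) (suc d , d<L , forward refl) =
    d , m≤n⇒m≤1+n (<⇒≤ d<L) , forward (next-injective y′≤m (fold-next≤m d x≤m) (sym e))
  Within-step x≤m y′≤m (inj₂ refl) (d , d≤L , backward refl) =
    suc d , s≤s d≤L , backward (fold-next _ d)

  Within-0-1 : 0 < m → Within 1 0 1
  Within-0-1 0<m = 1 , ≤-refl , forward (sym (next-suc 0<m))

-- The length of the route (a , 1) — (1 + a , 0) — (1 + a , 1) — ⋯ — (1 + Δ + a , 0).
crossing : ℕ → ℕ
crossing zero    = 1
crossing (suc Δ) = suc (suc (crossing Δ))

x+[c+y]≡y+[c+x] : ∀ x c y → x + (c + y) ≡ y + (c + x)
x+[c+y]≡y+[c+x] x c y = begin
  x + (c + y)   ≡⟨ x∙yz≈y∙xz x c y ⟩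
  c + (x + y)   ≡⟨ cong (c +_) (+-comm x y) ⟩
  c + (y + x)   ≡⟨ x∙yz≈y∙xz c y x ⟩
  y + (c + x)   ∎
  where open ≡-Reasoning

n<crossing : ∀ Δ → Δ < crossing Δ
n<crossing zero    = z<s
n<crossing (suc Δ) = s≤s (≤-trans (n<crossing Δ) (n≤1+n _))

module Stack (m : ℕ) where

  open Cycle m

  data Move : ℕ → ℕ → ℕ → ℕ → Set where
    along : ∀ {b k k′} → k′ ≡ next k ⊎ k ≡ next k′ → Move b k b k′
    up    : ∀ {b} → Move b 1 (suc b) 0
    down  : ∀ {b} → Move (suc b) 0 b 1

  -- Reach a j b k L holds whenever a walk of length L leads from (a , j) to (b , k): a walk into
  -- a copy above a spends L₁ steps from j to the exit 1, crossing Δ steps to the entry 0 of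
  -- copy suc (Δ + a), and L₂ steps from there; symmetrically below.
  data Reach (a j : ℕ) : ℕ → ℕ → ℕ → Set where
    same  : ∀ {k L} → Within L j k → Reach a j a k L
    above : ∀ Δ {k L L₁ L₂} → Within L₁ j 1 → Within L₂ 0 k → L₂ + (crossing Δ + L₁) ≤ L →
            Reach a j (suc (Δ + a)) k L
    below : ∀ Δ {b k L L₁ L₂} → a ≡ suc (Δ + b) → Within L₁ j 0 → Within L₂ 1 k →
            L₂ + (crossing Δ + L₁) ≤ L → Reach a j b k L

  private
    pay-step : ∀ {L₂ x L} → 1 ≤ L₂ → L₂ + x ≤ L → suc x ≤ L
    pay-step {suc L₂} _ ℓ = ≤-trans (s≤s (m≤n+m _ L₂)) ℓ

    back-across : ∀ {L₂} Δ {L₁ L} → L₂ + (crossing (suc Δ) + L₁) ≤ L → suc (crossing Δ + L₁) ≤ suc L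
    back-across {L₂} _ ℓ = s≤s (≤-trans (n≤1+n _) (≤-trans (n≤1+n _) (m+n≤o⇒n≤o L₂ ℓ)))

    back-home : ∀ {L₂ L₁ L} → L₂ + (crossing 0 + L₁) ≤ L → L₁ ≤ suc L
    back-home {L₂} ℓ = m≤n⇒m≤1+n (<⇒≤ (m+n≤o⇒n≤o L₂ ℓ))

  reach-step : ∀ {a j b k b′ k′ L} → 0 < m → j ≤ m → k′ ≤ m →
    Move b k b′ k′ → Reach a j b k L → Reach a j b′ k′ (suc L)
  reach-step _ j≤m k′≤m (along adj) (same w) = same (Within-step j≤m k′≤m adj w)
  reach-step _ _ k′≤m (along adj) (above Δ w₁ w₂ ℓ) =
    above Δ w₁ (Within-step z≤n k′≤m adj w₂) (s≤s ℓ)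
  reach-step 0<m _ k′≤m (along adj) (below Δ e w₁ w₂ ℓ) =
    below Δ e w₁ (Within-step 0<m k′≤m adj w₂) (s≤s ℓ)
  reach-step _ _ _ up (same w) = above 0 w Within-refl ≤-refl
  reach-step _ _ _ up (above Δ w₁ w₂ ℓ) =
    above (suc Δ) w₁ Within-refl (s≤s (pay-step (Within-pos (λ ()) w₂) ℓ))
  reach-step {a} {j} {L = L} _ _ _ up (below zero e w₁ w₂ ℓ) =
    subst (λ c → Reach a j c 0 (suc L)) e (same (Within-mono (back-home ℓ) w₁))
  reach-step 0<m _ _ up (below (suc Δ) e w₁ w₂ ℓ) =
    below Δ (trans e (cong suc (sym (+-suc Δ _)))) w₁ (Within-sym (Within-0-1 0<m)) (back-across Δ ℓ)
  reach-step _ _ _ down (same w) = below 0 refl w Within-refl ≤-refl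
  reach-step _ _ _ down (above zero w₁ w₂ ℓ) = same (Within-mono (back-home ℓ) w₁)
  reach-step 0<m _ _ down (above (suc Δ) w₁ w₂ ℓ) = above Δ w₁ (Within-0-1 0<m) (back-across Δ ℓ)
  reach-step _ _ _ down (below Δ e w₁ w₂ ℓ) =
    below (suc Δ) (trans e (cong suc (+-suc Δ _))) w₁ Within-refl
      (s≤s (pay-step (Within-pos (λ ()) w₂) ℓ))

-- Phases and colours

-- The phase of position j of the cycle 0, 1, …, 4s + 2 is origin for j = 0, residue j for
-- 1 ≤ j ≤ 4s, penult for 4s + 1 and final for 4s + 2. The phase of the next position is among
-- the successors, for every s: res₀ is followed by res₁, except at 4s where penult follows.
data Phase : Set where
  origin res₀ res₁ res₂ res₃ penult final : Phase

phases : List Phase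
phases = origin ∷ res₀ ∷ res₁ ∷ res₂ ∷ res₃ ∷ penult ∷ final ∷ []

∈-phases : ∀ p → p ∈ phases
∈-phases origin = here refl
∈-phases res₀   = there (here refl)
∈-phases res₁   = there (there (here refl))
∈-phases res₂   = there (there (there (here refl)))
∈-phases res₃   = there (there (there (there (here refl))))
∈-phases penult = there (there (there (there (there (here refl)))))
∈-phases final  = there (there (there (there (there (there (here refl))))))

residue : ℕ → Phase
residue 0 = res₀
residue 1 = res₁
residue 2 = res₂
residue 3 = res₃
residue (suc (suc (suc (suc j)))) = residue j

residue-4* : ∀ s → residue (4 * s) ≡ res₀
residue-4* zero    = refl
residue-4* (suc s) rewrite *-suc 4 s = residue-4* s

successors : Phase → List Phase
successors origin = res₁ ∷ []
successors res₀   = res₁ ∷ penult ∷ []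
successors res₁   = res₂ ∷ []
successors res₂   = res₃ ∷ []
successors res₃   = res₀ ∷ []
successors penult = final ∷ []
successors final  = origin ∷ []

predecessors : Phase → List Phase
predecessors origin = final ∷ []
predecessors res₀   = res₃ ∷ []
predecessors res₁   = origin ∷ res₀ ∷ []
predecessors res₂   = res₁ ∷ []
predecessors res₃   = res₂ ∷ []
predecessors penult = res₀ ∷ []
predecessors final  = penult ∷ []

residue-successor : ∀ j → residue (suc j) ∈ successors (residue j)
residue-successor 0 = here refl
residue-successor 1 = here refl
residue-successor 2 = here refl
residue-successor 3 = here refl
residue-successor (suc (suc (suc (suc j)))) = residue-successor j

∈-predecessors : ∀ {p q} → q ∈ successors p → p ∈ predecessors q
∈-predecessors {origin} (here refl)         = here refl
∈-predecessors {res₀}   (here refl)         = there (here refl)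
∈-predecessors {res₀}   (there (here refl)) = here refl
∈-predecessors {res₁}   (here refl)         = here refl
∈-predecessors {res₂}   (here refl)         = here refl
∈-predecessors {res₃}   (here refl)         = here refl
∈-predecessors {penult} (here refl)         = here refl
∈-predecessors {final}  (here refl)         = here refl

steps : (Phase → List Phase) → ℕ → Phase → List Phase
steps δ zero    p = p ∷ []
steps δ (suc d) p = concatMap δ (steps δ d p)

steps-snoc : ∀ δ d {p q r} → q ∈ steps δ d p → r ∈ δ q → r ∈ steps δ (suc d) p
steps-snoc δ _ q∈ r∈ = ∈-concatMap⁺ δ (lose q∈ r∈)

around : ℕ → Phase → List Phase
around d p = steps successors d p ++ steps predecessors d p

data Kind : Set where
  first odd even : Kind

kinds : List Kind
kinds = first ∷ odd ∷ even ∷ []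

∈-kinds : ∀ κ → κ ∈ kinds
∈-kinds first = here refl
∈-kinds odd   = there (here refl)
∈-kinds even  = there (there (here refl))

nextKind : Kind → Kind
nextKind first = odd
nextKind odd   = even
nextKind even  = odd

kind : ℕ → Kind
kind = fold first nextKind

-- Around the cycle from 0 the colours read 1 (3 1 2 1)ˢ 4 2 on the first copy,
-- 1 (2 1 3 1)ˢ 2 4 on odd copies and 1 (3 1 2 1)ˢ 4 5 on even ones.
colour : Kind → Phase → ℕ
colour _     origin = 1
colour _     res₀   = 1
colour _     res₂   = 1
colour first res₁   = 3
colour first res₃   = 2
colour first penult = 4
colour first final  = 2
colour odd   res₁   = 2
colour odd   res₃   = 3
colour odd   penult = 2
colour odd   final  = 4
colour even  res₁   = 3
colour even  res₃   = 2
colour even  penult = 4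
colour even  final  = 5

maxColour : Kind → ℕ
maxColour first = 4
maxColour odd   = 4
maxColour even  = 5

maxColour-first-two : ∀ {a} → a ≤ 1 → maxColour (kind a) ≡ 4
maxColour-first-two {zero}        _         = refl
maxColour-first-two {suc zero}    _         = refl
maxColour-first-two {suc (suc _)} (s≤s ())

maxColour≤5 : ∀ κ → maxColour κ ≤ 5
maxColour≤5 first = n≤1+n 4
maxColour≤5 odd   = n≤1+n 4
maxColour≤5 even  = ≤-refl

by-inspection : ∀ {P : Kind → Phase → Set} (P? : ∀ κ p → Dec (P κ p)) →
  True (all? (λ κ → all? (P? κ) phases) kinds) → ∀ κ p → P κ p
by-inspection P? ok κ p = lookup (lookup (toWitness ok) (∈-kinds κ)) (∈-phases p)

colour-range : ∀ κ p → 1 ≤ colour κ p × colour κ p ≤ maxColour κ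
colour-range = by-inspection (λ κ p → 1 ≤? colour κ p ×-dec colour κ p ≤? maxColour κ) _

colour≤5 : ∀ κ p → colour κ p ≤ 5
colour≤5 κ p = ≤-trans (proj₂ (colour-range κ p)) (maxColour≤5 κ)

apart-within : ∀ κ p {d q} → 1 ≤ d → d ≤ colour κ p → q ∈ steps successors d p →
  colour κ p ≢ colour κ q
apart-within κ p 1≤d d≤c = lookup (table κ p (s≤s (≤-trans d≤c (colour≤5 κ p))) 1≤d d≤c)
  where
  table : ∀ κ p {d} → d < 6 → 1 ≤ d → d ≤ colour κ p →
    All (λ q → colour κ p ≢ colour κ q) (steps successors d p)
  table = by-inspection (λ κ p → allUpTo? (λ d → 1 ≤? d →-dec (d ≤? colour κ p →-dec
            all? (λ q → ¬? (colour κ p ≟ colour κ q)) (steps successors d p))) 6) _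

apart-across : ∀ κ Δ {d₁ d₂ p q} → p ∈ around d₁ res₁ → q ∈ around d₂ origin →
  d₂ + (crossing Δ + d₁) ≤ colour κ p → colour κ p ≢ colour (fold κ nextKind (suc Δ)) q
apart-across κ Δ {d₁} {d₂} p∈ q∈ bound = lookup (lookup (table κ Δ<6 d₁<6 d₂<6) p∈ bound) q∈
  where
  total≤5 : d₂ + (crossing Δ + d₁) ≤ 5
  total≤5 = ≤-trans bound (colour≤5 κ _)
  Δ<6 : Δ < 6
  Δ<6 = m≤n⇒m≤1+n (<-≤-trans (n<crossing Δ) (m+n≤o⇒m≤o (crossing Δ) (m+n≤o⇒n≤o d₂ total≤5)))
  d₁<6 : d₁ < 6
  d₁<6 = s≤s (m+n≤o⇒n≤o (crossing Δ) (m+n≤o⇒n≤o d₂ total≤5))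
  d₂<6 : d₂ < 6
  d₂<6 = s≤s (m+n≤o⇒m≤o d₂ total≤5)
  table : ∀ κ {Δ} → Δ < 6 → ∀ {d₁} → d₁ < 6 → ∀ {d₂} → d₂ < 6 →
    All (λ p → d₂ + (crossing Δ + d₁) ≤ colour κ p →
               All (λ q → colour κ p ≢ colour (fold κ nextKind (suc Δ)) q) (around d₂ origin))
        (around d₁ res₁)
  table κ = lookup (toWitness {a? = all? (λ κ → allUpTo? (λ Δ → allUpTo? (λ d₁ → allUpTo? (λ d₂ →
              all? (λ p → d₂ + (crossing Δ + d₁) ≤? colour κ p →-dec
                     all? (λ q → ¬? (colour κ p ≟ colour (fold κ nextKind (suc Δ)) q))
                          (around d₂ origin))
                   (around d₁ res₁)) 6) 6) 6) kinds} _) (∈-kinds κ)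

-- The colouring of P₂ₜ ◇₂ C₄ₛ₊₃

toℕ-pair-injective : ∀ {s t} {i i′ : Fin s} {j j′ : Fin t} → (toℕ i , toℕ j) ≡ (toℕ i′ , toℕ j′) → (i , j) ≡ (i′ , j′)
toℕ-pair-injective e = cong₂ _,_ (toℕ-injective (cong proj₁ e)) (toℕ-injective (cong proj₂ e))

module Colouring (s : ℕ) (1≤s : 1 ≤ s) where

  m : ℕ
  m = suc (suc (4 * s))

  open Cycle m
  open Stack m

  1≤4s : 1 ≤ 4 * s
  1≤4s = ≤-trans (s≤s z≤n) (*-monoʳ-≤ 4 1≤s)

  phase : ℕ → Phase
  phase zero = origin
  phase j@(suc _) with j ≤? 4 * s | j ≟ suc (4 * s)
  ... | yes _ | _     = residue j
  ... | no _  | yes _ = penult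
  ... | no _  | no _  = final

  phase-inner : ∀ {j} → 1 ≤ j → j ≤ 4 * s → phase j ≡ residue j
  phase-inner {suc k} _ j≤4s with suc k ≤? 4 * s
  ... | yes _   = refl
  ... | no j≰4s = contradiction j≤4s j≰4s

  phase-penult : phase (suc (4 * s)) ≡ penult
  phase-penult with suc (4 * s) ≤? 4 * s | suc (4 * s) ≟ suc (4 * s)
  ... | yes 4s<4s | _        = contradiction 4s<4s (n≮n _)
  ... | no _      | yes _    = refl
  ... | no _      | no ¬refl = contradiction refl ¬refl

  phase-final : phase (suc (suc (4 * s))) ≡ final
  phase-final with suc (suc (4 * s)) ≤? 4 * s | suc (suc (4 * s)) ≟ suc (4 * s)
  ... | yes 2+4s≤4s | _      = contradiction 2+4s≤4s (<⇒≱ (n≤1+n _))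
  ... | no _        | yes eq = contradiction eq 1+n≢n
  ... | no _        | no _   = refl

  phase-one : phase 1 ≡ res₁
  phase-one = phase-inner ≤-refl 1≤4s

  data Position : ℕ → Set where
    at-origin : Position 0
    inside    : ∀ {j} → 1 ≤ j → j < 4 * s → Position j
    at-corner : Position (4 * s)
    at-penult : Position (suc (4 * s))
    at-final  : Position (suc (suc (4 * s)))

  position : ∀ {j} → j ≤ m → Position j
  position {zero} _ = at-origin
  position {j@(suc _)} j≤m with <-cmp j (4 * s)
  ... | tri< j<4s _ _ = inside (s≤s z≤n) j<4s
  ... | tri≈ _ j≡4s _ = subst Position (sym j≡4s) at-corner
  ... | tri> _ _ 4s<j with m≤n⇒m<n∨m≡n j≤m
  ...   | inj₂ refl = at-final
  ...   | inj₁ j<m  = subst Position (≤-antisym 4s<j (s≤s⁻¹ j<m)) at-penult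

  phase-next : ∀ {j} → j ≤ m → phase (next j) ∈ successors (phase j)
  phase-next j≤m with position j≤m
  ... | at-origin rewrite next-suc {0} z<s | phase-one = here refl
  ... | inside {j} 1≤j j<4s rewrite next-suc (m≤n⇒m≤1+n (m≤n⇒m≤1+n j<4s))
                                 | phase-inner (s≤s z≤n) j<4s | phase-inner 1≤j (<⇒≤ j<4s) =
    residue-successor j
  ... | at-corner rewrite next-suc (m≤n⇒m≤1+n (n<1+n (4 * s))) | phase-penult
                        | phase-inner 1≤4s ≤-refl | residue-4* s = there (here refl)
  ... | at-penult rewrite next-suc (n<1+n (suc (4 * s))) | phase-penult | phase-final = here refl
  ... | at-final  rewrite next-last | phase-final = here refl

  after-sound : ∀ {x} d → x ≤ m → phase (fold x next d) ∈ steps successors d (phase x)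
  after-sound zero    _   = here refl
  after-sound (suc d) x≤m =
    steps-snoc successors d (after-sound d x≤m) (phase-next (fold-next≤m d x≤m))

  before-sound : ∀ {x} d → x ≤ m → phase x ∈ steps predecessors d (phase (fold x next d))
  before-sound zero        _   = here refl
  before-sound {x} (suc d) x≤m =
    subst (λ y → phase x ∈ steps predecessors (suc d) (phase y)) (fold-next x d)
      (steps-snoc predecessors d (before-sound {next x} d (next≤m x))
                                 (∈-predecessors (phase-next x≤m)))

  arc-sound : ∀ {d x y} → x ≤ m → y ≤ m → Arc d x y → phase y ∈ around d (phase x)
  arc-sound {d} x≤m _   (forward refl) = ∈-++⁺ˡ (after-sound d x≤m)
  arc-sound {d} _   y≤m (backward refl) = ∈-++⁺ʳ _ (before-sound d y≤m)

  colourAt : ℕ → ℕ → ℕ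
  colourAt a j = colour (kind a) (phase j)

  kind-above : ∀ Δ a → kind (suc (Δ + a)) ≡ fold (kind a) nextKind (suc Δ)
  kind-above Δ a = fold-+ first nextKind (suc Δ)

  apart-within-copy : ∀ {a j k L} → j ≤ m → k ≤ m → j ≢ k → Within L j k → L ≤ colourAt a j →
    colourAt a j ≢ colourAt a k
  apart-within-copy _ _ j≢k (zero , _ , forward refl)  _ = contradiction refl j≢k
  apart-within-copy _ _ j≢k (zero , _ , backward refl) _ = contradiction refl j≢k
  apart-within-copy {a} {j} j≤m _ _ (suc d , d<L , forward refl) L≤c =
    apart-within (kind a) (phase j) (s≤s z≤n) (≤-trans d<L L≤c) (after-sound (suc d) j≤m)
  apart-within-copy {a} {k = k} _ k≤m _ (suc d , d<L , backward refl) L≤c same-colour =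
    apart-within (kind a) (phase k) (s≤s z≤n) (≤-trans d<L (≤-trans L≤c (≤-reflexive same-colour)))
      (after-sound (suc d) k≤m) (sym same-colour)

  apart-between-copies : ∀ {a j k Δ L₁ L₂} → j ≤ m → k ≤ m → Within L₁ j 1 → Within L₂ 0 k →
    L₂ + (crossing Δ + L₁) ≤ colourAt a j → colourAt a j ≢ colourAt (suc (Δ + a)) k
  apart-between-copies {a} {j} {k} {Δ} j≤m k≤m (d₁ , d₁≤L₁ , arc₁) (d₂ , d₂≤L₂ , arc₂) bound same-colour =
    apart-across (kind a) Δ {d₁} {d₂}
      (subst (λ p → phase j ∈ around d₁ p) phase-one (arc-sound (s≤s z≤n) j≤m (Arc-sym arc₁)))
      (arc-sound z≤n k≤m arc₂)
      (≤-trans (+-mono-≤ d₂≤L₂ (+-monoʳ-≤ (crossing Δ) d₁≤L₁)) bound)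
      (trans same-colour (cong (λ κ → colour κ (phase k)) (kind-above Δ a)))

  reach-separates : ∀ {a j b k L} → j ≤ m → k ≤ m → Reach a j b k L → L ≤ colourAt a j →
    (a , j) ≢ (b , k) → colourAt a j ≢ colourAt b k
  reach-separates {a} j≤m k≤m (same w) L≤c u≢v =
    apart-within-copy {a} j≤m k≤m (u≢v ∘ cong (a ,_)) w L≤c
  reach-separates {a} j≤m k≤m (above Δ w₁ w₂ ℓ) L≤c _ =
    apart-between-copies {a} j≤m k≤m w₁ w₂ (≤-trans ℓ L≤c)
  reach-separates {b = b} {k} j≤m k≤m (below Δ {L₁ = L₁} {L₂} refl w₁ w₂ ℓ) L≤c _ same-colour =
    apart-between-copies k≤m j≤m (Within-sym w₂) (Within-sym w₁) bound (sym same-colour)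
    where
    bound : L₁ + (crossing Δ + L₂) ≤ colourAt b k
    bound = subst (_≤ colourAt b k) (x+[c+y]≡y+[c+x] L₂ (crossing Δ) L₁)
              (≤-trans ℓ (≤-trans L≤c (≤-reflexive same-colour)))

  module _ {t : ℕ} where

    colouring : Fin t × Fin (suc m) → ℕ
    colouring (i , j) = colourAt (toℕ i) (toℕ j)

    move : ∀ {i k i′ k′} → Adj (PathAligned2Cycle t (suc m)) (i , k) (i′ , k′) →
      Move (toℕ i) (toℕ k) (toℕ i′) (toℕ k′)
    move (inj₁ (refl , adj)) = along adj
    move (inj₂ (inj₁ (i′≡1+i , k≡1 , k′≡0))) rewrite i′≡1+i | k≡1 | k′≡0 = up
    move (inj₂ (inj₂ (i≡1+i′ , k′≡1 , k≡0))) rewrite i≡1+i′ | k≡0 | k′≡1 = down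

    reach-along : ∀ {i j i′ k} (w : Walk (PathAligned2Cycle t (suc m)) (i , j) (i′ , k)) →
      Reach (toℕ i) (toℕ j) (toℕ i′) (toℕ k) (length w)
    reach-along {i} {j} = walk-invariant R step (same Within-refl)
      where
      R : Fin t × Fin (suc m) → ℕ → Set
      R (i′ , k) L = Reach (toℕ i) (toℕ j) (toℕ i′) (toℕ k) L
      step : ∀ {x y L} → Adj (PathAligned2Cycle t (suc m)) x y → R x L → R y (suc L)
      step {_ , _} {_ , k′} adj = reach-step z<s (toℕ≤pred[n] j) (toℕ≤pred[n] k′) (move adj)

    separated : ∀ u v → u ≢ v → colouring u ≡ colouring v →
      DistAtLeast (PathAligned2Cycle t (suc m)) u v (suc (colouring u))
    separated (i , j) (i′ , k) u≢v same-colour w with suc (colouring (i , j)) ≤? length w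
    ... | yes long = long
    ... | no short = ⊥-elim (reach-separates (toℕ≤pred[n] j) (toℕ≤pred[n] k) (reach-along w)
                               (≮⇒≥ short) (u≢v ∘ toℕ-pair-injective) same-colour)

    colouring-range : ∀ v → 1 ≤ colouring v × colouring v ≤ maxColour (kind (toℕ (proj₁ v)))
    colouring-range (i , j) = colour-range (kind (toℕ i)) (phase (toℕ j))

    packing₅ : IsPackingColoring (PathAligned2Cycle t (suc m)) 5 colouring
    packing₅ = range₅ , separated
      where
      range₅ : ∀ v → 1 ≤ colouring v × colouring v ≤ 5
      range₅ v = proj₁ (colouring-range v) , ≤-trans (proj₂ (colouring-range v)) (maxColour≤5 _)

    packing₄ : t ≤ 2 → IsPackingColoring (PathAligned2Cycle t (suc m)) 4 colouring
    packing₄ t≤2 = range₄ , separated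
      where
      range₄ : ∀ v → 1 ≤ colouring v × colouring v ≤ 4
      range₄ v@(i , _) = proj₁ (colouring-range v) ,
        subst (colouring v ≤_) (maxColour-first-two (s≤s⁻¹ (≤-trans (toℕ<n i) t≤2)))
              (proj₂ (colouring-range v))

  copy-cycle : ∀ {t} → OddCycle (PathAligned2Cycle (suc t) (suc m)) (suc (2 * s))
  copy-cycle {t} = record { vertex = vertex ; edge = edge ; closed = closed ; simple = simple }
    where
    open ≡-Reasoning

    cycle-length : suc (suc (2 * s) * 2) ≡ suc m
    cycle-length = cong (3 +_) (trans (*-comm (2 * s) 2) (sym (*-assoc 2 2 s)))

    toℕ-mod : ∀ q → toℕ (q mod suc m) ≡ q % suc m
    toℕ-mod q = toℕ-fromℕ< (m%n<n q (suc m))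

    vertex : ℕ → Fin (suc t) × Fin (suc m)
    vertex q = F.zero , q mod suc m

    edge : ∀ q → Adj (PathAligned2Cycle (suc t) (suc m)) (vertex q) (vertex (suc q))
    edge q = inj₁ (refl , inj₁ (begin
      toℕ (suc q mod suc m)         ≡⟨ toℕ-mod (suc q) ⟩
      suc q % suc m                 ≡⟨ [m+o%n]%n≡[m+o]%n 1 q (suc m) ⟨
      suc (q % suc m) % suc m       ≡⟨ cong (λ r → suc r % suc m) (toℕ-mod q) ⟨
      suc (toℕ (q mod suc m)) % suc m ∎))

    closed : ∀ q → vertex (q + suc (suc (2 * s) * 2)) ≡ vertex q
    closed q rewrite cycle-length = cong (F.zero ,_) (toℕ-injective (begin
      toℕ ((q + suc m) mod suc m)   ≡⟨ toℕ-mod (q + suc m) ⟩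
      (q + suc m) % suc m           ≡⟨ [m+n]%n≡m%n q (suc m) ⟩
      q % suc m                     ≡⟨ toℕ-mod q ⟨
      toℕ (q mod suc m)             ∎))

    simple : ∀ q d → suc d < suc (suc (2 * s) * 2) → vertex q ≢ vertex (suc d + q)
    simple q d 1+d<len eq = [m+o]%n≢o%n q z<s (subst (suc d <_) cycle-length 1+d<len) (begin
      (suc d + q) % suc m           ≡⟨ toℕ-mod (suc d + q) ⟨
      toℕ ((suc d + q) mod suc m)   ≡⟨ cong (toℕ ∘ proj₂) eq ⟨
      toℕ (q mod suc m)             ≡⟨ toℕ-mod q ⟩
      q % suc m                     ∎)

  ¬packing-3-colouring : ∀ {t k} → k ≤ 3 → ¬ HasPackingColoring (PathAligned2Cycle (suc t) (suc m)) k
  ¬packing-3-colouring = odd-cycle⇒¬packing-3-colouring copy-cycle (s≤s (≤-trans 1≤s (m≤m+n s _)))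

theorem11 : (s t : ℕ) → 1 ≤ s → 1 ≤ t →
    (t ≤ 2 → HasPackingColoring (PathAligned2Cycle t (4 * s + 3)) 4
             × PackingChromaticNumberIs (PathAligned2Cycle t (4 * s + 3)) 4)
    × (3 ≤ t → HasPackingColoring (PathAligned2Cycle t (4 * s + 3)) 5)
theorem11 s (suc t) 1≤s _ rewrite +-comm (4 * s) 3 =
  (λ t≤2 → (colouring , packing₄ t≤2) , (colouring , packing₄ t≤2) ,
           λ k k<4 → ¬packing-3-colouring (s≤s⁻¹ k<4)) ,
  λ _ → colouring , packing₅
  where open Colouring s 1≤s
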